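{- Let $V$ be a finite set, $\mathcal{F},\mathcal{C}\subseteq 2^V$, and let $M$ be the $\mathcal{F}\times\mathcal{C}$ matrix with $M(f,c)=1$ if $c$ splits $f$ and $M(f,c)=0$ otherwise. Then $\mathrm{trk}(M)\le|V|-1$.
   Context: A set $c$ splits a set $f$ if $c\cap f\ne\emptyset$ and $f\setminus c\ne\emptyset$. The triangular rank $\mathrm{trk}(M)$ is the size of the largest square submatrix (rows and columns in any order) that is lower triangular with strictly positive diagonal. -}

module Defs where

open import Data.Nat using (ℕ; _<_; _≡ᵇ_)
open import Data.Bool using (if_then_else_)
open import Data.Fin using (Fin)
import Data.Fin as F
open import Data.Fin.Subset using (Subset; _∩_; _─_; Nonempty)
open import Data.Fin.Subset.Properties using (nonempty?)
open import Data.Product using (_×_; Σ; ∃; _,_)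
open import Relation.Nullary using (Dec; does)
open import Relation.Nullary.Decidable using (_×-dec_)
open import Relation.Binary.PropositionalEquality using (_≡_)
open import Function.Definitions using (Injective)

Splits : ∀ {n} → Subset n → Subset n → Set
Splits c f = Nonempty (c ∩ f) × Nonempty (f ─ c)

splits? : ∀ {n} (c f : Subset n) → Dec (Splits c f)
splits? c f = nonempty? (c ∩ f) ×-dec nonempty? (f ─ c)

-- M(f, c) = 1 if c splits f, 0 otherwise (entries for all f, c ⊆ V;
-- the matrix of the theorem is its restriction to rows in 𝓕, columns in 𝓒)
splitMatrix : ∀ {n} → Subset n → Subset n → ℕ
splitMatrix f c = if does (splits? c f) then 1 else 0

-- A k×k submatrix of M restricted to rows satisfying R and columns
-- satisfying C (rows/columns chosen distinct, in any order via r and c)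
-- which is lower triangular with strictly positive diagonal.
record TriangularSubmatrix {A B : Set} (R : A → Set) (C : B → Set)
                           (M : A → B → ℕ) (k : ℕ) : Set where
  field
    row      : Fin k → A
    col      : Fin k → B
    row-inj  : Injective _≡_ _≡_ row
    col-inj  : Injective _≡_ _≡_ col
    row-in   : ∀ i → R (row i)
    col-in   : ∀ j → C (col j)
    upper0   : ∀ i j → i F.< j → M (row i) (col j) ≡ 0
    diagPos  : ∀ i → 0 < M (row i) (col i)

-- trk(M) ≤ t  (trk is the largest such k)
TrkAtMost : {A B : Set} (R : A → Set) (C : B → Set) (M : A → B → ℕ) → ℕ → Set
TrkAtMost R C M t = ∀ k → TriangularSubmatrix R C M k → k Data.Nat.≤ t

-- A k × k lower-triangular submatrix with positive diagonal is a sequence of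
-- pivots (f₀, c₀), …, (f_{k-1}, c_{k-1}) such that cᵢ splits fᵢ and, for
-- i < j, c_j does not split fᵢ.  Listing the pivots last-first gives a
-- "triangular list": the column of each pivot splits its own row but none of
-- the rows after it.  The key lemma bounds a triangular list whose rows all lie
-- in a set W by ∣W∣ - 1, by well-founded induction on its length.  The head
-- column c splits its row f ⊆ W, so W ∩ c and W ─ c are both nonempty; every
-- later row is not split by c, so it lies in W ∩ c or in W ─ c.  Filtering the
-- tail accordingly gives two shorter triangular lists, bounded by ∣W ∩ c∣ - 1
-- and ∣W ─ c∣ - 1, and 1 + (∣W ∩ c∣ - 1) + (∣W ─ c∣ - 1) = ∣W∣ - 1.
-- The theorem is the case W = V, after reading a triangular list off the
-- submatrix.
module Submission where

open import Defs
open import Data.Bool using (if_then_else_)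
open import Data.Empty using (⊥-elim)
open import Data.Fin using (Fin; fromℕ; inject₁)
import Data.Fin as F
open import Data.Fin.Properties using (toℕ<n; toℕ-inject₁; toℕ-fromℕ)
open import Data.Fin.Subset
  using (Subset; _∩_; _─_; Nonempty; Empty; _∈_; _∉_; _⊆_; ∣_∣; ⊤; inside; outside)
open import Data.Fin.Subset.Properties using (_∈?_; nonempty?; x∈p∩q⁺; x∈p∩q⁻; ∣⊤∣≡n; ⊆⊤)
open import Data.List using (List; []; _∷_; length; filter)
open import Data.List.Properties using (length-filter)
open import Data.List.Relation.Unary.All as All using (All; []; _∷_)
open import Data.List.Relation.Unary.All.Properties using (all-filter)
  renaming (filter⁺ to All-filter⁺)
open import Data.List.Relation.Unary.AllPairs using (AllPairs; []; _∷_)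
open import Data.List.Relation.Unary.AllPairs.Properties using ()
  renaming (filter⁺ to AllPairs-filter⁺)
open import Data.Nat using (ℕ; zero; suc; _+_; _∸_; _≤_; _<_; z≤n; s≤s)
open import Data.Nat.Induction using (<-wellFounded)
open import Data.Nat.Properties using (+-suc; +-mono-≤; module ≤-Reasoning)
open import Data.Product using (_×_; _,_; proj₁; proj₂)
open import Data.Vec using ([]; _∷_; here; there)
open import Function using (_∘_)
open import Induction.WellFounded using (Acc; acc)
open import Level using (0ℓ)
open import Relation.Binary.PropositionalEquality using (_≡_; refl; sym; cong; subst; subst₂)
open import Relation.Nullary using (Dec; yes; no; ¬_; does)
open import Relation.Nullary.Decidable using (decidable-stable)
open import Relation.Unary using (Pred; Decidable)
open import Relation.Unary.Properties using (∁?)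

x∈p─q⁺ : ∀ {m} {p q : Subset m} {x} → x ∈ p → x ∉ q → x ∈ p ─ q
x∈p─q⁺ {p = inside ∷ _} {outside ∷ _} here        x∉q = here
x∈p─q⁺ {p = inside ∷ _} {inside ∷ _}  here        x∉q = ⊥-elim (x∉q here)
x∈p─q⁺ {p = _ ∷ _}      {_ ∷ _}       (there x∈p) x∉q = there (x∈p─q⁺ x∈p (x∉q ∘ there))

x∈p─q⁻ : ∀ {m} {p q : Subset m} {x} → x ∈ p ─ q → x ∈ p × x ∉ q
x∈p─q⁻ {p = inside ∷ _}  {outside ∷ _} here = here , λ ()
x∈p─q⁻ {p = _ ∷ _}       {inside ∷ _}  {F.zero} ()
x∈p─q⁻ {p = outside ∷ _} {outside ∷ _} {F.zero} ()
x∈p─q⁻ {p = _ ∷ p}       {_ ∷ q}       (there x∈p─q) =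
  there (proj₁ (x∈p─q⁻ {p = p} {q} x∈p─q)) , λ { (there x∈q) → proj₂ (x∈p─q⁻ x∈p─q) x∈q }

∣p∩q∣+∣p─q∣≡∣p∣ : ∀ {m} (p q : Subset m) → ∣ p ∩ q ∣ + ∣ p ─ q ∣ ≡ ∣ p ∣
∣p∩q∣+∣p─q∣≡∣p∣ []            []            = refl
∣p∩q∣+∣p─q∣≡∣p∣ (inside ∷ p)  (inside ∷ q)  = cong suc (∣p∩q∣+∣p─q∣≡∣p∣ p q)
∣p∩q∣+∣p─q∣≡∣p∣ (inside ∷ p)  (outside ∷ q) =
  subst (λ s → s ≡ suc ∣ p ∣) (sym (+-suc ∣ p ∩ q ∣ ∣ p ─ q ∣)) (cong suc (∣p∩q∣+∣p─q∣≡∣p∣ p q))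
∣p∩q∣+∣p─q∣≡∣p∣ (outside ∷ p) (inside ∷ q)  = ∣p∩q∣+∣p─q∣≡∣p∣ p q
∣p∩q∣+∣p─q∣≡∣p∣ (outside ∷ p) (outside ∷ q) = ∣p∩q∣+∣p─q∣≡∣p∣ p q

nonempty⇒∣p∣>0 : ∀ {m} {p : Subset m} → Nonempty p → 0 < ∣ p ∣
nonempty⇒∣p∣>0 {p = inside ∷ _}  _                     = s≤s z≤n
nonempty⇒∣p∣>0 {p = outside ∷ _} (F.suc x , there x∈p) = nonempty⇒∣p∣>0 (x , x∈p)

splits⇒parts-nonempty : ∀ {m} {W f c : Subset m} →
                        f ⊆ W → Splits c f → Nonempty (W ∩ c) × Nonempty (W ─ c)
splits⇒parts-nonempty {f = f} {c = c} f⊆W ((x , x∈c∩f) , (y , y∈f─c)) =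
  (x , x∈p∩q⁺ (f⊆W (proj₂ x∈c×f) , proj₁ x∈c×f)) ,
  (y , x∈p─q⁺ (f⊆W (proj₁ y∈f×y∉c)) (proj₂ y∈f×y∉c))
  where
  x∈c×f : x ∈ c × x ∈ f
  x∈c×f = x∈p∩q⁻ c f x∈c∩f
  y∈f×y∉c : y ∈ f × y ∉ c
  y∈f×y∉c = x∈p─q⁻ {p = f} {c} y∈f─c

no-excess⇒⊆∩ : ∀ {m} {W f c : Subset m} → f ⊆ W → Empty (f ─ c) → f ⊆ W ∩ c
no-excess⇒⊆∩ {c = c} f⊆W empty {x} x∈f =
  x∈p∩q⁺ (f⊆W x∈f , decidable-stable (x ∈? c) (λ x∉c → empty (x , x∈p─q⁺ x∈f x∉c)))

unsplit⇒⊆─ : ∀ {m} {W f c : Subset m} → f ⊆ W → ¬ Splits c f → Nonempty (f ─ c) → f ⊆ W ─ c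
unsplit⇒⊆─ f⊆W unsplit excess {x} x∈f =
  x∈p─q⁺ (f⊆W x∈f) (λ x∈c → unsplit ((x , x∈p∩q⁺ (x∈c , x∈f)) , excess))

length-filter-∁+filter : ∀ {A : Set} {Q : Pred A 0ℓ} (Q? : Decidable Q) (xs : List A) →
                         length (filter (∁? Q?) xs) + length (filter Q? xs) ≡ length xs
length-filter-∁+filter Q? [] = refl
length-filter-∁+filter Q? (x ∷ xs) with Q? x
... | yes _ = subst (λ s → s ≡ suc (length xs)) (sym (+-suc _ _))
                    (cong suc (length-filter-∁+filter Q? xs))
... | no _  = cong suc (length-filter-∁+filter Q? xs)

all-filter-with : ∀ {A : Set} {P Q R : Pred A 0ℓ} (Q? : Decidable Q) →
                  (∀ {x} → P x → Q x → R x) → ∀ {xs} → All P xs → All R (filter Q? xs)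
all-filter-with Q? combine {xs} all-P =
  All.zipWith (λ (p , q) → combine p q) (All-filter⁺ Q? all-P , all-filter Q? xs)

tabulate↓ : ∀ {A : Set} {k} → (Fin k → A) → List A
tabulate↓ {k = zero}  g = []
tabulate↓ {k = suc k} g = g (fromℕ k) ∷ tabulate↓ (g ∘ inject₁)

length-tabulate↓ : ∀ {A : Set} {k} (g : Fin k → A) → length (tabulate↓ g) ≡ k
length-tabulate↓ {k = zero}  g = refl
length-tabulate↓ {k = suc k} g = cong suc (length-tabulate↓ (g ∘ inject₁))

All-tabulate↓ : ∀ {A : Set} {P : Pred A 0ℓ} {k} (g : Fin k → A) →
                (∀ i → P (g i)) → All P (tabulate↓ g)
All-tabulate↓ {k = zero}  g Pg = []
All-tabulate↓ {k = suc k} g Pg = Pg (fromℕ k) ∷ All-tabulate↓ (g ∘ inject₁) (Pg ∘ inject₁)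

inject₁<fromℕ : ∀ {k} (i : Fin k) → inject₁ i F.< fromℕ k
inject₁<fromℕ {k} i = subst₂ _<_ (sym (toℕ-inject₁ i)) (sym (toℕ-fromℕ k)) (toℕ<n i)

inject₁-mono-< : ∀ {k} {i j : Fin k} → i F.< j → inject₁ i F.< inject₁ j
inject₁-mono-< {i = i} {j} = subst₂ _<_ (sym (toℕ-inject₁ i)) (sym (toℕ-inject₁ j))

AllPairs-tabulate↓ : ∀ {A : Set} {R : A → A → Set} {k} (g : Fin k → A) →
                     (∀ {i j} → i F.< j → R (g j) (g i)) → AllPairs R (tabulate↓ g)
AllPairs-tabulate↓ {k = zero}  g R-g = []
AllPairs-tabulate↓ {k = suc k} g R-g =
  All-tabulate↓ (g ∘ inject₁) (λ i → R-g (inject₁<fromℕ i)) ∷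
  AllPairs-tabulate↓ (g ∘ inject₁) (R-g ∘ inject₁-mono-<)

Pivot : ℕ → Set
Pivot n = Subset n × Subset n

Triangular : ∀ {n} → List (Pivot n) → Set
Triangular L = All (λ (f , c) → Splits c f) L × AllPairs (λ (_ , c) (f′ , _) → ¬ Splits c f′) L

RowsIn : ∀ {n} → Subset n → List (Pivot n) → Set
RowsIn W L = All (λ (f , _) → f ⊆ W) L

triangular-filter : ∀ {n} {Q : Pred (Pivot n) 0ℓ} (Q? : Decidable Q) {L : List (Pivot n)} →
                    Triangular L → Triangular (filter Q? L)
triangular-filter Q? (splits , unsplits) = All-filter⁺ Q? splits , AllPairs-filter⁺ Q? unsplits

suc-+-≤-pred : ∀ {a b p q} → 0 < p → 0 < q → a ≤ p ∸ 1 → b ≤ q ∸ 1 → suc (a + b) ≤ p + q ∸ 1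
suc-+-≤-pred {a} {b} {suc p} {suc q} _ _ a≤p b≤q = begin
  suc (a + b) ≤⟨ s≤s (+-mono-≤ a≤p b≤q) ⟩
  suc (p + q) ≡⟨ sym (+-suc p q) ⟩
  p + suc q   ∎
  where open ≤-Reasoning

triangular-length-acc : ∀ {n} (W : Subset n) (L : List (Pivot n)) → Acc _<_ (length L) →
                        Triangular L → RowsIn W L → length L ≤ ∣ W ∣ ∸ 1
triangular-length-acc W [] _ _ _ = z≤n
triangular-length-acc {n} W ((f , c) ∷ L) (acc shorter)
                      (split ∷ splits , unsplit ∷ unsplits) (f⊆W ∷ rows⊆W) = begin
  suc (length L)                        ≡⟨ cong suc (sym (length-filter-∁+filter Outside? L)) ⟩
  suc (length inner + length outer)     ≤⟨ suc-+-≤-pred (nonempty⇒∣p∣>0 (proj₁ parts))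
                                                        (nonempty⇒∣p∣>0 (proj₂ parts))
                                                        inner-bound outer-bound ⟩
  ∣ W ∩ c ∣ + ∣ W ─ c ∣ ∸ 1             ≡⟨ cong (_∸ 1) (∣p∩q∣+∣p─q∣≡∣p∣ W c) ⟩
  ∣ W ∣ ∸ 1                             ∎
  where
  open ≤-Reasoning
  -- Later rows lie either inside c or (having a point outside c) outside c.
  Outside? : Decidable (λ (p : Pivot n) → Nonempty (proj₁ p ─ c))
  Outside? (f′ , _) = nonempty? (f′ ─ c)

  inner outer : List (Pivot n)
  inner = filter (∁? Outside?) L
  outer = filter Outside? L

  parts : Nonempty (W ∩ c) × Nonempty (W ─ c)
  parts = splits⇒parts-nonempty f⊆W split

  tail-rows : All (λ (f′ , _) → f′ ⊆ W × ¬ Splits c f′) L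
  tail-rows = All.zip (rows⊆W , unsplit)

  inner-bound : length inner ≤ ∣ W ∩ c ∣ ∸ 1
  inner-bound = triangular-length-acc (W ∩ c) inner (shorter (s≤s (length-filter _ L)))
    (triangular-filter _ (splits , unsplits))
    (all-filter-with (∁? Outside?) (λ (f′⊆W , _) → no-excess⇒⊆∩ f′⊆W) tail-rows)

  outer-bound : length outer ≤ ∣ W ─ c ∣ ∸ 1
  outer-bound = triangular-length-acc (W ─ c) outer (shorter (s≤s (length-filter _ L)))
    (triangular-filter _ (splits , unsplits))
    (all-filter-with Outside? (λ (f′⊆W , u) → unsplit⇒⊆─ f′⊆W u) tail-rows)

triangular-length : ∀ {n} (W : Subset n) (L : List (Pivot n)) →
                    Triangular L → RowsIn W L → length L ≤ ∣ W ∣ ∸ 1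
triangular-length W L = triangular-length-acc W L (<-wellFounded (length L))

indicator-pos : ∀ {P : Set} (d : Dec P) → 0 < (if does d then 1 else 0) → P
indicator-pos (yes p) _ = p

indicator-zero : ∀ {P : Set} (d : Dec P) → (if does d then 1 else 0) ≡ 0 → ¬ P
indicator-zero (no ¬p) _ = ¬p

submatrix-triangular : ∀ {n} {𝓕 𝓒 : Subset n → Set} {k}
                       (T : TriangularSubmatrix 𝓕 𝓒 splitMatrix k) →
                       let open TriangularSubmatrix T in
                       Triangular (tabulate↓ (λ i → row i , col i))
submatrix-triangular {n} {k = k} T =
  All-tabulate↓ pivot (λ i → indicator-pos (splits? _ _) (diagPos i)) ,
  AllPairs-tabulate↓ pivot (λ {i} {j} i<j → indicator-zero (splits? _ _) (upper0 i j i<j))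
  where
  open TriangularSubmatrix T
  pivot : Fin k → Pivot n
  pivot i = row i , col i

mainTheorem15 : (n : ℕ) (𝓕 𝓒 : Subset n → Set) →
                TrkAtMost 𝓕 𝓒 splitMatrix (n ∸ 1)
mainTheorem15 n 𝓕 𝓒 k T =
  subst₂ (λ len size → len ≤ size ∸ 1) (length-tabulate↓ pivot) (∣⊤∣≡n n)
    (triangular-length ⊤ (tabulate↓ pivot) (submatrix-triangular T)
      (All-tabulate↓ pivot (λ _ → ⊆⊤)))
  where
  open TriangularSubmatrix T
  pivot : Fin k → Pivot n
  pivot i = row i , col i
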